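{- Let $\mathcal X:=2^\omega=\{0,1\}^{\mathbb N}$ with the Cantor ultrametric and let $\mathsf{Tree}_2$ be the Polish space of binary trees with the product topology. The map $\Psi:\mathsf{Tree}_2\to C(\mathcal X,\mathcal X)$, $S\mapsto F_S$ (defined below), is continuous when $C(\mathcal X,\mathcal X)$ carries the uniform metric $\|F-G\|_\infty=\sup_{x\in\mathcal X}d_{\mathcal X}(F(x),G(x))$. In particular $\Psi$ is Borel.
   Context: $d_{\mathcal X}(x,y)=2^{ -\min\{n\ge1:x_n\ne y_n\}}$ for $x\ne y$. $\mathsf{Tree}_2$ is the set of subsets of $2^{<\omega}$ closed under initial segments, as a subspace of $\{0,1\}^{2^{<\omega}}$; $S\cap2^m$ denotes the nodes of length $m$. For $u\in\{0,1,\ast\}^m$ let $\Sigma(u)=\{\tau\in2^m:\forall i,\ u(i)\in\{0,1\}\Rightarrow\tau(i)=u(i)\}$. Star-priority witness: $u_0(S)$ is the empty word; if $u_{m-1}(S)=\bot$ then $u_m(S)=\bot$; otherwise $u_m(S)$ is the first among $u_{m-1}(S)\frown\ast$, $u_{m-1}(S)\frown0$, $u_{m-1}(S)\frown1$ (in this order) with $\Sigma(v)\subseteq S\cap2^m$, and $\bot$ if none works. $P_m(S)=\Sigma(u_m(S))$ if $u_m(S)\ne\bot$ and $P_m(S)=\varnothing$ otherwise. For $P\subseteq2^m$, list $2^m\setminus P=(\rho_1,\dots,\rho_\ell)$ lexicographically and let $\pi_{m,P}$ swap $\rho_{2j-1}\leftrightarrow\rho_{2j}$ for $1\le j\le\lfloor\ell/2\rfloor$,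 fix $\rho_\ell$ if $\ell$ is odd, and fix $P$ pointwise; $\mathrm{succ}_{m,P}$ is a fixed single-cycle permutation of $P$ (cyclic successor). Let $x_\infty=(1,1,\dots)$ and $\mathcal Y_m=\{x:x_1=\dots=x_{m-1}=1,x_m=0\}$. Define $F_S(x_\infty)=x_\infty$, and for $x\in\mathcal Y_m$ with $\tau(x)=(x_{m+1},\dots,x_{2m})$ and $P=P_m(S)$: $\tau'(x)=\mathrm{succ}_{m,P}(\tau(x))$ if $P\ne\varnothing$ and $\tau(x)\in P$, and $\tau'(x)=\pi_{m,P}(\tau(x))$ if $\tau(x)\notin P$; $F_S(x)$ has coordinates $x_n$ for $n\le m$ or $n>2m$ and $\tau'(x)_{n-m}$ for $m<n\le2m$. -}

module Defs where

open import Data.Nat using (ℕ; zero; suc; _+_; _*_; _∸_; _≤_; _<_; _≤ᵇ_)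
open import Data.Bool using (Bool; true; false; if_then_else_; not; _∧_; _∨_)
open import Data.List using (List; []; _∷_; _++_; map; length; [_])
open import Data.Maybe using (Maybe; just; nothing)
open import Data.Product using (_×_; ∃)
open import Relation.Binary.PropositionalEquality using (_≡_)
open import Relation.Nullary.Decidable using (does)
open import Data.Bool.Properties using () renaming (_≟_ to _≟ᵇ_)

-- Cantor space X = {0,1}^ℕ, represented as ℕ → Bool, 0-BASED:
-- the paper's coordinate x_n (n ≥ 1) is  x (n ∸ 1).  Bit 1 = true, 0 = false.

Cantor : Set
Cantor = ℕ → Bool

-- x and y agree on their first k coordinates (x_1..x_k), i.e.
-- d_X(x,y) < 2^{-k}  (equivalently ≤ 2^{-(k+1)}).
AgreeUpTo : ℕ → Cantor → Cantor → Set
AgreeUpTo k x y = ∀ i → i < k → x i ≡ y i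

-- Binary words and trees.  A point of {0,1}^{2^{<ω}} is a map
-- List Bool → Bool (characteristic function of a subset of 2^{<ω}).

Word : Set
Word = List Bool

Sub : Set
Sub = Word → Bool

IsTree : Sub → Set
IsTree S = ∀ (u v : Word) → S (u ++ v) ≡ true → S u ≡ true

-- S and S' agree on all nodes of length ≤ N (basic neighbourhoods of
-- the product topology on {0,1}^{2^{<ω}})
AgreeDepth : ℕ → Sub → Sub → Set
AgreeDepth N S S' = ∀ (w : Word) → length w ≤ N → S w ≡ S' w

eqW : Word → Word → Bool
eqW [] [] = true
eqW (a ∷ u) (b ∷ v) = does (a ≟ᵇ b) ∧ eqW u v
eqW _ _ = false

elemW : Word → List Word → Bool
elemW τ [] = false
elemW τ (a ∷ L) = eqW τ a ∨ elemW τ L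

allB : (Word → Bool) → List Word → Bool
allB p [] = true
allB p (a ∷ L) = p a ∧ allB p L

allWords : ℕ → List Word
allWords zero = [ [] ]
allWords (suc m) = map (false ∷_) (allWords m) ++ map (true ∷_) (allWords m)

data Star : Set where
  ∗   : Star
  bit : Bool → Star

Σw : List Star → List Word
Σw [] = [ [] ]
Σw (∗ ∷ u) = map (false ∷_) (Σw u) ++ map (true ∷_) (Σw u)
Σw (bit b ∷ u) = map (b ∷_) (Σw u)

-- Σ(v) ⊆ S ∩ 2^m   (length is automatic)
fits : Sub → List Star → Bool
fits S v = allB S (Σw v)

-- star-priority witness u_m(S); nothing = ⊥
uW : Sub → ℕ → Maybe (List Star)
uW S zero = just []
uW S (suc m) with uW S m
... | nothing = nothing
... | just u =
  if fits S (u ++ [ ∗ ]) then just (u ++ [ ∗ ])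
  else if fits S (u ++ [ bit false ]) then just (u ++ [ bit false ])
  else if fits S (u ++ [ bit true ]) then just (u ++ [ bit true ])
  else nothing

Pm : Sub → ℕ → List Word
Pm S m with uW S m
... | nothing = []
... | just u = Σw u

swapPairs : List Word → Word → Word
swapPairs (a ∷ b ∷ r) τ = if eqW τ a then b else (if eqW τ b then a else swapPairs r τ)
swapPairs _ τ = τ

filterB : (Word → Bool) → List Word → List Word
filterB p [] = []
filterB p (a ∷ L) = if p a then a ∷ filterB p L else filterB p L

πmP : ℕ → List Word → Word → Word
πmP m P τ = swapPairs (filterB (λ ρ → not (elemW ρ P)) (allWords m)) τ

-- succ_{m,P}: the fixed single-cycle permutation of P, chosen as the
-- cyclic successor in the lexicographic order of P (last ↦ first).
cycSucc : List Word → Word → Word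
cycSucc [] τ = τ
cycSucc (a₀ ∷ L₀) τ = go (a₀ ∷ L₀)
  where
  go : List Word → Word
  go (a ∷ b ∷ r) = if eqW τ a then b else go (b ∷ r)
  go _ = a₀

τ′ : Sub → ℕ → Word → Word
τ′ S m τ = if elemW τ (Pm S m) then cycSucc (Pm S m) τ else πmP m (Pm S m) τ

-- fz x k = just m  iff m ∈ [1,k] is least with x_m = 0; nothing if x_1..x_k all 1
fz : Cantor → ℕ → Maybe ℕ
fz x zero = nothing
fz x (suc k) = if x 0 then Data.Maybe.map suc (fz (λ i → x (suc i)) k) else just 1

-- (x_{a+1}, …, x_{a+len})
block : Cantor → ℕ → ℕ → Word
block x a zero = []
block x a (suc len) = x a ∷ block x (suc a) len

-- 1-based indexing with default
nth1 : Word → ℕ → Bool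
nth1 [] _ = false
nth1 (b ∷ w) (suc zero) = b
nth1 (b ∷ w) (suc (suc n)) = nth1 w (suc n)
nth1 (b ∷ w) zero = false

-- Output coordinate n = j+1 (0-based index j).  x lies in Y_m with
-- m < n iff fz x j = just m (looking at x_1..x_{n-1}); if so and n ≤ 2m the
-- coordinate is τ'(x)_{n-m}, otherwise (including x = x_∞, or x ∈ Y_m with
-- m ≥ n, or n > 2m) it is x_n.

F : Sub → Cantor → Cantor
F S x j with fz x j
... | nothing = x j
... | just m = if suc j ≤ᵇ (m + m) then nth1 (τ′ S m (block x m m)) (suc j ∸ m) else x j

{-# OPTIONS --safe #-}
module Submission where

open import Defs
open import Data.Nat using (ℕ; zero; suc; _+_; _≤_; _<_; z≤n; s≤s)
open import Data.Nat.Properties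
  using (≤-trans; ≤-reflexive; <⇒≤; m≤n⇒m≤1+n; m≤m+n; m<m+n; +-mono-≤; +-suc; +-comm)
open import Data.Product using (Σ; _×_; _,_)
open import Data.Bool using (true; false; _∧_)
open import Data.List using (List; []; _∷_; _++_; length; [_])
open import Data.List.Properties using (length-++)
open import Data.List.Relation.Unary.All as All using (All; []; _∷_)
open import Data.List.Relation.Unary.All.Properties using (map⁺; ++⁺)
open import Data.Maybe using (just; nothing)
open import Relation.Binary.PropositionalEquality using (_≡_; refl; sym; trans; cong; cong₂)

-- Coordinate n of F_S(x) only looks at the first m < n with x_m = 0, at the block
-- x_{m+1} … x_{2m} and at P_m(S); the last depends only on S ∩ 2^{≤m}, since the
-- star-priority witness is built one level at a time.

AgreeUpTo-mono : ∀ {k n x y} → k ≤ n → AgreeUpTo n x y → AgreeUpTo k x y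
AgreeUpTo-mono k≤n ag i i<k = ag i (≤-trans i<k k≤n)

fz-cong : ∀ j {x y} → AgreeUpTo j x y → fz x j ≡ fz y j
fz-cong zero    ag = refl
fz-cong (suc j) {x} {y} ag
  rewrite ag 0 (s≤s z≤n)
        | fz-cong j {λ i → x (suc i)} {λ i → y (suc i)} (λ i i<j → ag (suc i) (s≤s i<j)) = refl

fz-bound : ∀ x j {m} → fz x j ≡ just m → m ≤ j
fz-bound x (suc j) e with x 0 | fz (λ i → x (suc i)) j in eq
fz-bound x (suc j) refl | false | _      = s≤s z≤n
fz-bound x (suc j) refl | true  | just _ = s≤s (fz-bound (λ i → x (suc i)) j eq)

block-cong : ∀ a len {x y} → AgreeUpTo (a + len) x y → block x a len ≡ block y a len
block-cong a zero    ag = refl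
block-cong a (suc len) ag =
  cong₂ _∷_ (ag a (m<m+n a (s≤s z≤n)))
            (block-cong (suc a) len (AgreeUpTo-mono (≤-reflexive (sym (+-suc a len))) ag))

F-coord-congˣ : ∀ S j {x y} → AgreeUpTo (suc (j + j)) x y → F S x j ≡ F S y j
F-coord-congˣ S j {x} {y} ag
  rewrite fz-cong j (AgreeUpTo-mono (m≤n⇒m≤1+n (m≤m+n j j)) ag)
  with fz y j in eq
... | nothing = ag j (s≤s (m≤m+n j j))
... | just m
  rewrite block-cong m m
            (AgreeUpTo-mono (m≤n⇒m≤1+n (+-mono-≤ (fz-bound y j eq) (fz-bound y j eq))) ag)
        | ag j (s≤s (m≤m+n j j)) = refl

F-congˣ : ∀ S k {x y} → AgreeUpTo (k + k) x y → AgreeUpTo k (F S x) (F S y)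
F-congˣ S k ag j j<k = F-coord-congˣ S j (AgreeUpTo-mono (+-mono-≤ j<k (<⇒≤ j<k)) ag)

Σw-length : ∀ u → All (λ w → length w ≡ length u) (Σw u)
Σw-length []          = refl ∷ []
Σw-length (∗ ∷ u)     = ++⁺ (map⁺ (All.map (cong suc) (Σw-length u)))
                            (map⁺ (All.map (cong suc) (Σw-length u)))
Σw-length (bit b ∷ u) = map⁺ (All.map (cong suc) (Σw-length u))

allB-cong : ∀ {p q} L → All (λ w → p w ≡ q w) L → allB p L ≡ allB q L
allB-cong []      []         = refl
allB-cong (w ∷ L) (e ∷ es) = cong₂ _∧_ e (allB-cong L es)

fits-cong : ∀ {N S S′} → AgreeDepth N S S′ → ∀ v → length v ≤ N → fits S v ≡ fits S′ v
fits-cong {N} ag v v≤N =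
  allB-cong (Σw v) (All.map (λ {w} e → ag w (≤-trans (≤-reflexive e) v≤N)) (Σw-length v))

length-snoc : ∀ {A : Set} (v : List A) c → length (v ++ [ c ]) ≡ suc (length v)
length-snoc v c = trans (length-++ v) (+-comm (length v) 1)

uW-length : ∀ S m {u} → uW S m ≡ just u → length u ≡ m
uW-length S zero refl = refl
uW-length S (suc m) e with uW S m in eq
... | just v with fits S (v ++ [ ∗ ]) | fits S (v ++ [ bit false ]) | fits S (v ++ [ bit true ])
uW-length S (suc m) refl | just v | true  | _     | _
  rewrite length-snoc v ∗ = cong suc (uW-length S m eq)
uW-length S (suc m) refl | just v | false | true  | _
  rewrite length-snoc v (bit false) = cong suc (uW-length S m eq)
uW-length S (suc m) refl | just v | false | false | true
  rewrite length-snoc v (bit true) = cong suc (uW-length S m eq)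

uW-extension-≤ : ∀ S {m N v} → uW S m ≡ just v → m < N → ∀ c → length (v ++ [ c ]) ≤ N
uW-extension-≤ S {m} {v = v} eq m<N c =
  ≤-trans (≤-reflexive (trans (length-snoc v c) (cong suc (uW-length S m eq)))) m<N

uW-cong : ∀ {N S S′} → AgreeDepth N S S′ → ∀ m → m ≤ N → uW S m ≡ uW S′ m
uW-cong ag zero    m≤N = refl
uW-cong {S′ = S′} ag (suc m) m<N
  rewrite uW-cong ag m (<⇒≤ m<N)
  with uW S′ m in eq
... | nothing = refl
... | just v
  rewrite fits-cong ag (v ++ [ ∗ ])         (uW-extension-≤ S′ eq m<N ∗)
        | fits-cong ag (v ++ [ bit false ]) (uW-extension-≤ S′ eq m<N (bit false))
        | fits-cong ag (v ++ [ bit true ])  (uW-extension-≤ S′ eq m<N (bit true)) = refl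

F-coord-congˢ : ∀ {N S S′} → AgreeDepth N S S′ → ∀ x j → j ≤ N → F S x j ≡ F S′ x j
F-coord-congˢ ag x j j≤N with fz x j in eq
... | nothing = refl
... | just m rewrite uW-cong ag m (≤-trans (fz-bound x j eq) j≤N) = refl

F-congˢ : ∀ {k S S′} → AgreeDepth k S S′ → ∀ x → AgreeUpTo k (F S x) (F S′ x)
F-congˢ ag x j j<k = F-coord-congˢ ag x j (<⇒≤ j<k)

lemma4p7 :
    -- each F_S is a (continuous) self-map of X, so Ψ lands in C(X,X) ...
    ((S : Sub) → IsTree S → (x : Cantor) → (k : ℕ) →
      Σ ℕ (λ N → (y : Cantor) → AgreeUpTo N x y → AgreeUpTo k (F S x) (F S y)))
    ×
    -- ... and Ψ : S ↦ F_S is continuous from Tree_2 to (C(X,X), ‖·‖_∞)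
    ((S : Sub) → IsTree S → (k : ℕ) →
      Σ ℕ (λ N → (S′ : Sub) → IsTree S′ → AgreeDepth N S S′ →
        (x : Cantor) → AgreeUpTo k (F S x) (F S′ x)))
lemma4p7 = (λ S _ x k → k + k , λ y → F-congˣ S k)
         , (λ S _ k → k , λ S′ _ ag → F-congˢ ag)
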